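{- Work intuitionistically. Let $X$ be a topological space with interior operator $\mathrm{int}$ on subsets of $X$, and weak closure operator $\mathrm{cl}$ on subsets of $X$, where for $D\subseteq X$, $x\in\mathrm{cl}\,D$ iff for every open $A$ with $x\in A$ the set $D\cap A$ is inhabited. Then: 1. if $\mathrm{int}\,\mathrm{cl}\,D=\mathrm{cl}\,D$ for all $D\subseteq X$, then $\mathrm{cl}\,\mathrm{int}\,D=\mathrm{int}\,D$ for all $D\subseteq X$; 2. if $\mathrm{cl}\,\mathrm{int}\,D=\mathrm{int}\,D$ for all $D\subseteq X$ and $X$ is $T0$, then $X$ is $T1$; 3. if $\mathrm{int}\,\mathrm{cl}\,D=\mathrm{cl}\,D$ for all $D\subseteq X$ and $X$ is $T1$, then $X$ is discrete (every subset is open).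
   Context: $X$ is called $T0$ if $\mathrm{cl}\{x\}=\mathrm{cl}\{y\}$ implies $x=y$ for all points $x,y$; $X$ is called $T1$ if $\mathrm{cl}\{x\}=\{x\}$ for every point $x$. Here $\mathrm{cl}$ is the weak closure (set of adherent points) defined in the claim, not the complement of the interior of the complement. -}

module Defs where

open import Level using (0ℓ)
open import Data.Product using (Σ; _×_)
open import Relation.Binary.PropositionalEquality using (_≡_)
open import Relation.Unary using (Pred; _∈_; _⊆_; _≐_; _∩_; ｛_｝)

-- Subsets are
-- (proof-relevant) predicates; equality of subsets is extensional (_≐_).
record Space : Set₁ where
  field
    Carrier : Set
    Opn     : Set
    ⟦_⟧     : Opn → Pred Carrier 0ℓ
    top     : Σ Opn λ U → (∀ x → x ∈ ⟦ U ⟧)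
    inter   : ∀ U V → Σ Opn λ W → ⟦ W ⟧ ≐ (⟦ U ⟧ ∩ ⟦ V ⟧)
    union   : (I : Set) (f : I → Opn) →
              Σ Opn λ W → ⟦ W ⟧ ≐ (λ x → Σ I λ i → x ∈ ⟦ f i ⟧)

module _ (S : Space) where
  open Space S

  IsOpen : Pred Carrier 0ℓ → Set
  IsOpen D = Σ Opn λ U → ⟦ U ⟧ ≐ D

  int : Pred Carrier 0ℓ → Pred Carrier 0ℓ
  int D x = Σ Opn λ A → x ∈ ⟦ A ⟧ × ⟦ A ⟧ ⊆ D

  cl : Pred Carrier 0ℓ → Pred Carrier 0ℓ
  cl D x = ∀ A → x ∈ ⟦ A ⟧ → Σ Carrier λ y → y ∈ (D ∩ ⟦ A ⟧)

  T0 : Set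
  T0 = ∀ x y → cl ｛ x ｝ ≐ cl ｛ y ｝ → x ≡ y

  T1 : Set
  T1 = ∀ x → cl ｛ x ｝ ≐ ｛ x ｝

  Discrete : Set₁
  Discrete = ∀ (D : Pred Carrier 0ℓ) → IsOpen D

module Submission where

-- If every closure is open, each x has an open neighbourhood U ⊆ cl {x}; every
-- point of U specializes to x, so any open O met by U already contains x.  This
-- gives cl int D ⊆ int D, and for a T1 space it makes every singleton open.
-- If every open set is closed, specialization (y ∈ cl {x}) becomes symmetric,
-- so y ∈ cl {x} forces cl {x} = cl {y}, and T0 yields y = x.

open import Defs
open import Level using (0ℓ)
open import Data.Product using (Σ; _×_; _,_; proj₁; proj₂)
open import Function using (id)
open import Relation.Unary using (Pred; _∈_; _⊆_; _≐_; ｛_｝)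
open import Relation.Binary.PropositionalEquality using (refl; subst)

module _ (S : Space) where
  open Space S

  ⊆-cl : ∀ {D : Pred Carrier 0ℓ} → D ⊆ cl S D
  ⊆-cl {x = x} x∈D A x∈A = x , x∈D , x∈A

  cl-mono : ∀ {D E : Pred Carrier 0ℓ} → D ⊆ E → cl S D ⊆ cl S E
  cl-mono D⊆E x∈clD A x∈A with x∈clD A x∈A
  ... | y , y∈D , y∈A = y , D⊆E y∈D , y∈A

  int-⊆ : ∀ {D : Pred Carrier 0ℓ} → int S D ⊆ D
  int-⊆ (A , x∈A , A⊆D) = A⊆D x∈A

  int-mono : ∀ {D E : Pred Carrier 0ℓ} → D ⊆ E → int S D ⊆ int S E
  int-mono D⊆E (A , x∈A , A⊆D) = A , x∈A , λ y∈A → D⊆E (A⊆D y∈A)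

  ⟦⟧⊆int : ∀ A → ⟦ A ⟧ ⊆ int S ⟦ A ⟧
  ⟦⟧⊆int A x∈A = A , x∈A , id

  ⊆int⇒IsOpen : ∀ {D : Pred Carrier 0ℓ} → D ⊆ int S D → IsOpen S D
  ⊆int⇒IsOpen {D} D⊆intD = W , ⟦W⟧⊆D , D⊆⟦W⟧
    where
    nbhd : ∀ {x} → x ∈ D → Opn
    nbhd x∈D = proj₁ (D⊆intD x∈D)
    W : Opn
    W = proj₁ (union (Σ Carrier D) λ (_ , x∈D) → nbhd x∈D)
    ⟦W⟧⊆D : ⟦ W ⟧ ⊆ D
    ⟦W⟧⊆D z∈W with proj₁ (proj₂ (union _ _)) z∈W
    ... | (x , x∈D) , z∈nbhd = proj₂ (proj₂ (D⊆intD x∈D)) z∈nbhd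
    D⊆⟦W⟧ : D ⊆ ⟦ W ⟧
    D⊆⟦W⟧ {x} x∈D = proj₂ (proj₂ (union _ _)) ((x , x∈D) , proj₁ (proj₂ (D⊆intD x∈D)))

  cl-｛｝⇒∈⟦⟧ : ∀ {x z} → z ∈ cl S ｛ x ｝ → ∀ A → z ∈ ⟦ A ⟧ → x ∈ ⟦ A ⟧
  cl-｛｝⇒∈⟦⟧ z∈cl A z∈A with z∈cl A z∈A
  ... | _ , refl , x∈A = x∈A

  cl-｛｝-trans : ∀ {x y z} → z ∈ cl S ｛ x ｝ → x ∈ cl S ｛ y ｝ → z ∈ cl S ｛ y ｝
  cl-｛｝-trans z∈clx x∈cly A z∈A = x∈cly A (cl-｛｝⇒∈⟦⟧ z∈clx A z∈A)

  ∈int-cl-｛｝⇒cl-int⊆int : (∀ x → x ∈ int S (cl S ｛ x ｝)) →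
                           ∀ {D : Pred Carrier 0ℓ} → cl S (int S D) ⊆ int S D
  ∈int-cl-｛｝⇒cl-int⊆int inIntCl {x = x} x∈clintD with inIntCl x
  ... | U , x∈U , U⊆clx with x∈clintD U x∈U
  ... | y , (O , y∈O , O⊆D) , y∈U = O , cl-｛｝⇒∈⟦⟧ (U⊆clx y∈U) O y∈O , O⊆D

  cl-⟦⟧⊆⟦⟧⇒cl-｛｝-sym : (∀ A → cl S ⟦ A ⟧ ⊆ ⟦ A ⟧) →
                        ∀ {x y} → y ∈ cl S ｛ x ｝ → x ∈ cl S ｛ y ｝
  cl-⟦⟧⊆⟦⟧⇒cl-｛｝-sym closedOpens {x} {y} y∈clx A x∈A =
    y , refl , closedOpens A λ B y∈B → x , x∈A , cl-｛｝⇒∈⟦⟧ y∈clx B y∈B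

  cl-｛｝-sym∧T0⇒T1 : (∀ {x y} → y ∈ cl S ｛ x ｝ → x ∈ cl S ｛ y ｝) → T0 S → T1 S
  cl-｛｝-sym∧T0⇒T1 sym t0 x = y∈clx⇒x≡y , λ { refl → ⊆-cl refl }
    where
    y∈clx⇒x≡y : cl S ｛ x ｝ ⊆ ｛ x ｝
    y∈clx⇒x≡y {y} y∈clx = t0 x y
      ( (λ z∈clx → cl-｛｝-trans z∈clx (sym y∈clx))
      , (λ z∈cly → cl-｛｝-trans z∈cly y∈clx) )

  int-cl≐cl⇒∈int-cl-｛｝ : (∀ (D : Pred Carrier 0ℓ) → int S (cl S D) ≐ cl S D) →
                          ∀ x → x ∈ int S (cl S ｛ x ｝)
  int-cl≐cl⇒∈int-cl-｛｝ h x = proj₂ (h ｛ x ｝) (⊆-cl refl)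

  int-cl≐cl⇒cl-int≐int : (∀ (D : Pred Carrier 0ℓ) → int S (cl S D) ≐ cl S D) →
                        ∀ (D : Pred Carrier 0ℓ) → cl S (int S D) ≐ int S D
  int-cl≐cl⇒cl-int≐int h D = ∈int-cl-｛｝⇒cl-int⊆int (int-cl≐cl⇒∈int-cl-｛｝ h) , ⊆-cl

  cl-int≐int⇒T0⇒T1 : (∀ (D : Pred Carrier 0ℓ) → cl S (int S D) ≐ int S D) →
                     T0 S → T1 S
  cl-int≐int⇒T0⇒T1 h = cl-｛｝-sym∧T0⇒T1 (cl-⟦⟧⊆⟦⟧⇒cl-｛｝-sym closedOpens)
    where
    closedOpens : ∀ A → cl S ⟦ A ⟧ ⊆ ⟦ A ⟧
    closedOpens A x∈clA = int-⊆ (proj₁ (h ⟦ A ⟧) (cl-mono (⟦⟧⊆int A) x∈clA))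

  int-cl≐cl⇒T1⇒Discrete : (∀ (D : Pred Carrier 0ℓ) → int S (cl S D) ≐ cl S D) →
                          T1 S → Discrete S
  int-cl≐cl⇒T1⇒Discrete h t1 D = ⊆int⇒IsOpen λ {x} x∈D →
    int-mono (λ y∈clx → subst D (proj₁ (t1 x) y∈clx) x∈D) (int-cl≐cl⇒∈int-cl-｛｝ h x)

lemma2p1 : (S : Space) →
    ((∀ (D : Pred (Space.Carrier S) 0ℓ) → int S (cl S D) ≐ cl S D) →
       ∀ (D : Pred (Space.Carrier S) 0ℓ) → cl S (int S D) ≐ int S D)
    × ((∀ (D : Pred (Space.Carrier S) 0ℓ) → cl S (int S D) ≐ int S D) →
       T0 S → T1 S)
    × ((∀ (D : Pred (Space.Carrier S) 0ℓ) → int S (cl S D) ≐ cl S D) →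
       T1 S → Discrete S)
lemma2p1 S = int-cl≐cl⇒cl-int≐int S , cl-int≐int⇒T0⇒T1 S , int-cl≐cl⇒T1⇒Discrete S
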